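{- Let $n\ge 2$. Every $\pi\in M_{2n,\binom{2n-1}{2}}$ is a cyclic shift of $[2\ 4\ 6\ \cdots\ 2n-2\ 1\ 3\ 5\ \cdots\ 2n-1]$, i.e. there is $a\in\mathbb Z_{2n-1}$ with $\pi(x)=\sigma(x-a)$ for all $x\in\mathbb Z_{2n-1}$, where $\sigma=[2\ 4\ \cdots\ 2n-2\ 1\ 3\ \cdots\ 2n-1]$.
   Context: Permutations in $S_N$ are bijections of $\mathbb Z_N$ written $[\pi(1)\ \cdots\ \pi(N)]$. Pointers: entry $k$ has left pointer $(k-1,k)$ and right pointer $(k,k+1)$; the pointer word $W(\pi)$ lists $L(\pi(1))R(\pi(1))\cdots L(\pi(N))R(\pi(N))$ with $(0,1)$ and $(N,N+1)$ removed. Two distinct pointers form a valid pointer context if their occurrences in $W(\pi)$ interleave ($p\ldots q\ldots p\ldots q$ or $q\ldots p\ldots q\ldots p$). Strategic pile: with $X_N=(0\ 1\ \cdots\ N)$, $Y_\pi=(\pi(N)\ \cdots\ \pi(1)\ 0)$ in cycle notation and $C_\pi=Y_\pi\circ X_N$, $\mathrm{SP}(\pi)$ is the set of numbers after $N$ and before $0$ in the cycle of $C_\pi$ containing $0$ and $N$ (empty if different cycles). $\pi\in S_{2n}$ has maximal strategic pile if $|\mathrm{SP}(\pi)|=2n-1$; then $2n$ is immediately followed by $1$, and its contraction is the element of $S_{2n-1}$ obtained by deleting the entry $2n$. $M_{2n,k}$ is the set of contractions of permutations in $S_{2n}$ with maximal strategic pile and exactly $k$ valid pointer contexts. -}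

module Defs where

open import Data.Nat using (ℕ; zero; suc; _+_; _*_; _∸_; _≤_; _<_; _≡ᵇ_)
open import Data.Nat.Properties using (_≟_; _≤?_; _<?_)
open import Data.Nat.DivMod using (_%_)
open import Data.Bool using (Bool; true; false; if_then_else_; _∧_; not)
open import Data.List using (List; []; _∷_; _++_; map; filter; upTo; length; concatMap; reverse)
open import Data.List.Relation.Binary.Permutation.Propositional using (_↭_)
open import Data.List.Relation.Binary.Sublist.DecPropositional _≟_ using (_⊆_; _⊆?_)
open import Data.Maybe using (Maybe; just; nothing)
open import Data.Product using (Σ; _×_; _,_; proj₁; proj₂)
open import Data.Sum using (_⊎_)
open import Relation.Nullary.Decidable using (Dec; _⊎-dec_; _×-dec_; ¬?)
open import Relation.Binary.PropositionalEquality using (_≡_)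

-- Permutations in one-line notation.
-- A permutation π ∈ S_N is the list [π(1) … π(N)]; it must be a
-- rearrangement of [1 … N].

oneToN : ℕ → List ℕ
oneToN N = map suc (upTo N)

IsPerm : ℕ → List ℕ → Set
IsPerm N p = p ↭ oneToN N

-- 0-based lookup with default 0:  at p i = π(i+1)
at : List ℕ → ℕ → ℕ
at []      _       = 0
at (x ∷ _) zero    = x
at (_ ∷ xs) (suc i) = at xs i

-- Cycles in cycle notation: cyc (c₁ … c_r) maps c_i ↦ c_{i+1},
-- c_r ↦ c₁, and fixes everything else (entries assumed distinct).

cycGo : ℕ → List ℕ → ℕ → ℕ
cycGo h []           v = v
cycGo h (x ∷ [])     v = if x ≡ᵇ v then h else v
cycGo h (x ∷ y ∷ r)  v = if x ≡ᵇ v then y else cycGo h (y ∷ r) v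

cyc : List ℕ → ℕ → ℕ
cyc []      v = v
cyc (h ∷ t) v = cycGo h (h ∷ t) v

X : ℕ → ℕ → ℕ
X N = cyc (upTo (suc N))

Y : List ℕ → ℕ → ℕ
Y p = cyc (reverse p ++ (0 ∷ []))

Cπ : ℕ → List ℕ → ℕ → ℕ
Cπ N p v = Y p (X N v)

-- If we come back to N without meeting 0,
-- then 0 and N lie in different cycles and the pile is empty.
-- (Fuel N+1 suffices since C_π permutes {0,…,N}.)

walk : ℕ → List ℕ → ℕ → ℕ → Maybe (List ℕ)
walk N p zero     x = nothing
walk N p (suc f)  x =
  if x ≡ᵇ 0 then just []
  else if x ≡ᵇ N then nothing
  else consM (walk N p f (Cπ N p x))
  where
  consM : Maybe (List ℕ) → Maybe (List ℕ)
  consM (just l) = just (x ∷ l)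
  consM nothing  = nothing

SP : ℕ → List ℕ → List ℕ
SP N p with walk N p (suc N) (Cπ N p N)
... | just l  = l
... | nothing = []

-- The pointer (j, j+1) is encoded by the number j.
-- Entry k has left pointer (k-1,k) ↦ k-1 and right pointer (k,k+1) ↦ k.
-- The pointers (0,1) and (N,N+1), i.e. codes 0 and N, are removed.

pointerWord : ℕ → List ℕ → List ℕ
pointerWord N p =
  concatMap (λ k → filter (λ c → (1 ≤? c) ×-dec (c <? N)) (k ∸ 1 ∷ k ∷ [])) p

Interleave : List ℕ → ℕ → ℕ → Set
Interleave W p q = ((p ∷ q ∷ p ∷ q ∷ []) ⊆ W) ⊎ ((q ∷ p ∷ q ∷ p ∷ []) ⊆ W)

interleave? : (W : List ℕ) (p q : ℕ) → Dec (Interleave W p q)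
interleave? W p q = ((p ∷ q ∷ p ∷ q ∷ []) ⊆? W) ⊎-dec ((q ∷ p ∷ q ∷ p ∷ []) ⊆? W)

pointers : ℕ → List ℕ
pointers N = map suc (upTo (N ∸ 1))

pointerPairs : ℕ → List (ℕ × ℕ)
pointerPairs N =
  concatMap (λ p → map (λ q → (p , q)) (filter (λ q → p <? q) (pointers N))) (pointers N)

validContexts : ℕ → List ℕ → ℕ
validContexts N π =
  length (filter (λ pq → interleave? (pointerWord N π) (proj₁ pq) (proj₂ pq)) (pointerPairs N))

MaxSP : ℕ → List ℕ → Set
MaxSP n π = length (SP (2 * n) π) ≡ 2 * n ∸ 1

contraction : ℕ → List ℕ → List ℕ
contraction n π = filter (λ x → ¬? (x ≟ 2 * n)) π

InM : ℕ → ℕ → List ℕ → Set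
InM n k π = Σ (List ℕ) λ τ →
  IsPerm (2 * n) τ × MaxSP n τ × validContexts (2 * n) τ ≡ k × contraction n τ ≡ π

sigma : ℕ → List ℕ
sigma n = map (λ i → 2 * suc i) (upTo (n ∸ 1)) ++ map (λ i → suc (2 * i)) (upTo n)

-- x mod m (with x mod 0 = x, never used)
modN : ℕ → ℕ → ℕ
modN x zero    = x
modN x (suc m) = x % suc m

-- Deleting the entry 2n deletes only the pointer (2n−1, 2n), so when all C(2n−1, 2) pairs of
-- pointers of τ interleave, all pairs of pointers of its contraction π ∈ S_{2n−1} interleave
-- too.  Read the positions of π on the circle
-- ℤ_{2n−1}.  Two non-adjacent pointers (c, c+1) and (d, d+1) interleave only if the
-- chords {pos c, pos (c+1)} and {pos d, pos (d+1)} cross, and the adjacent pointers c and c+1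
-- interleave only if pos c, pos (c+2), pos (c+1) are in cyclic order.  If the place right
-- after pos j held some v ≠ j+2, the chord from it to the neighbouring value v ± 1 would have
-- to cross both {pos j, pos (j+1)} and {pos (j+1), pos (j+2)}, which these cyclic orders
-- forbid.  Hence j+2 always follows j: reading from the place of 2 one sees 2, 4, …, 2n−2,
-- then 1 (a w ≥ 3 there would follow both w−2 and 2n−2, and 2 cannot come back after only
-- n−1 steps), and then 3, 5, …, 2n−1.

module Submission where

open import Defs
open import Data.Nat using (ℕ; zero; suc; _+_; _*_; _∸_; _≤_; _<_; z≤n; s≤s)
open import Data.Nat.Properties
open import Data.Nat.Combinatorics using (_C_; nC1≡n; nCk+nC[k+1]≡[n+1]C[k+1])
open import Data.Nat.DivMod using (_%_; m<n⇒m%n≡m; n%n≡0; m%n<n; %-distribˡ-+; m%n%n≡m%n; m≤n⇒[n∸m]%m≡n%m; [m+n]%n≡m%n)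
open import Data.Nat.ListAction using (sum)
open import Data.Nat.ListAction.Properties using (sum-++)
open import Data.Empty using (⊥; ⊥-elim)
open import Data.Product using (Σ; _×_; _,_; proj₁; proj₂)
open import Data.Sum using (_⊎_; inj₁; inj₂; [_,_]′)
open import Data.List using (List; []; _∷_; _++_; map; filter; upTo; applyUpTo; length; concatMap)
open import Data.List.Properties
  using (length-map; length-upTo; length-++; map-++; map-upTo; upTo-∷ʳ; ++-identityʳ;
         filter-++; filter-accept; filter-reject; filter-complete; filter-all; filter-none)
open import Data.List.Membership.Propositional using (_∈_; lose)
open import Data.List.Membership.Propositional.Properties
  using (∈-map⁺; ∈-map⁻; ∈-upTo⁺; ∈-upTo⁻; ∈-filter⁺; ∈-concatMap⁺)
open import Data.List.Relation.Unary.All as All using (All; []; _∷_)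
import Data.List.Relation.Unary.All.Properties as All
open import Data.List.Relation.Unary.AllPairs using (AllPairs; []; _∷_)
import Data.List.Relation.Unary.AllPairs.Properties as AllPairs
open import Data.List.Relation.Unary.Any using (here; there)
open import Data.List.Relation.Unary.Unique.Propositional using (Unique)
import Data.List.Relation.Unary.Unique.Propositional.Properties as Unique
open import Data.List.Relation.Binary.Permutation.Propositional using (↭-sym; ↭-trans; ↭-reflexive; ↭⇒↭ₛ)
open import Data.List.Relation.Binary.Permutation.Propositional.Properties using (∈-resp-↭; ↭-length; filter-↭)
open import Data.List.Relation.Binary.Permutation.Setoid.Properties using (Unique-resp-↭)
open import Data.List.Relation.Binary.Sublist.Propositional using (_⊆_; []; _∷_; _∷ʳ_)
open import Data.List.Relation.Binary.Sublist.Propositional.Properties using (All-resp-⊆; filter⁺)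
open import Function using (_∘_; _∘′_)
open import Relation.Binary using (Tri; tri<; tri≈; tri>)
open import Relation.Binary.PropositionalEquality
  using (_≡_; _≢_; refl; sym; trans; cong; cong₂; subst; setoid; module ≡-Reasoning)
open import Relation.Nullary using (¬_; Dec; yes; no)
open import Relation.Nullary.Decidable using (_×-dec_; ¬?)

at-∈ : ∀ xs {i} → i < length xs → at xs i ∈ xs
at-∈ (x ∷ xs) {zero}  _       = here refl
at-∈ (x ∷ xs) {suc i} (s≤s p) = there (at-∈ xs p)

∈⇒at : ∀ {x} xs → x ∈ xs → Σ ℕ λ i → i < length xs × at xs i ≡ x
∈⇒at (_ ∷ xs) (here refl) = 0 , s≤s z≤n , refl
∈⇒at (_ ∷ xs) (there x∈) with ∈⇒at xs x∈
... | i , i< , eq = suc i , s≤s i< , eq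

at-injective : ∀ {xs} → Unique xs → ∀ {i j} → i < length xs → j < length xs → at xs i ≡ at xs j → i ≡ j
at-injective _                  {zero}  {zero}  _       _       _  = refl
at-injective {_ ∷ xs} (x∉ ∷ _)  {zero}  {suc j} _       (s≤s q) eq = ⊥-elim (All.lookup x∉ (at-∈ xs q) eq)
at-injective {_ ∷ xs} (x∉ ∷ _)  {suc i} {zero}  (s≤s p) _       eq = ⊥-elim (All.lookup x∉ (at-∈ xs p) (sym eq))
at-injective (_ ∷ unique)       {suc i} {suc j} (s≤s p) (s≤s q) eq = cong suc (at-injective unique p q eq)

at-++ˡ : ∀ xs ys {t} → t < length xs → at (xs ++ ys) t ≡ at xs t
at-++ˡ (x ∷ xs) ys {zero}  _       = refl
at-++ˡ (x ∷ xs) ys {suc t} (s≤s p) = at-++ˡ xs ys p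

at-++ʳ : ∀ xs ys t → at (xs ++ ys) (length xs + t) ≡ at ys t
at-++ʳ []       ys t = refl
at-++ʳ (x ∷ xs) ys t = at-++ʳ xs ys t

at-applyUpTo : ∀ (f : ℕ → ℕ) n {t} → t < n → at (applyUpTo f n) t ≡ f t
at-applyUpTo f (suc n) {zero}  _       = refl
at-applyUpTo f (suc n) {suc t} (s≤s p) = at-applyUpTo (f ∘ suc) n p

at-map-upTo : ∀ (f : ℕ → ℕ) n {t} → t < n → at (map f (upTo n)) t ≡ f t
at-map-upTo f n p = trans (cong (λ l → at l _) (map-upTo f n)) (at-applyUpTo f n p)

map-filter-∘ : ∀ {A B : Set} {P : B → Set} (f : A → B) (P? : ∀ y → Dec (P y)) xs →
               map f (filter (P? ∘ f) xs) ≡ filter P? (map f xs)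
map-filter-∘ f P? [] = refl
map-filter-∘ f P? (x ∷ xs) with P? (f x)
... | yes _ = cong (f x ∷_) (map-filter-∘ f P? xs)
... | no _  = map-filter-∘ f P? xs

⊆-map⁻ : ∀ {A B : Set} (f : A → B) {xs : List B} ys → xs ⊆ map f ys →
         Σ (List A) λ zs → zs ⊆ ys × map f zs ≡ xs
⊆-map⁻ f []       []        = [] , [] , refl
⊆-map⁻ f (y ∷ ys) (_ ∷ʳ xs⊆) with ⊆-map⁻ f ys xs⊆
... | zs , zs⊆ , eq = zs , y ∷ʳ zs⊆ , eq
⊆-map⁻ f (y ∷ ys) (refl ∷ xs⊆) with ⊆-map⁻ f ys xs⊆
... | zs , zs⊆ , eq = y ∷ zs , refl ∷ zs⊆ , cong (f y ∷_) eq

All-filter-guarded : ∀ {A : Set} {P Q : A → Set} (P? : ∀ x → Dec (P x)) {xs} →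
                     All (λ x → P x → Q x) xs → All Q (filter P? xs)
All-filter-guarded P? []                  = []
All-filter-guarded P? {x ∷ _} (q ∷ qs) with P? x
... | yes p = q p ∷ All-filter-guarded P? qs
... | no _  = All-filter-guarded P? qs

AllPairs-resp-⊆ : ∀ {A : Set} {R : A → A → Set} {xs ys} → xs ⊆ ys → AllPairs R ys → AllPairs R xs
AllPairs-resp-⊆ []          []         = []
AllPairs-resp-⊆ (_ ∷ʳ xs⊆)  (_ ∷ rys)  = AllPairs-resp-⊆ xs⊆ rys
AllPairs-resp-⊆ (refl ∷ xs⊆) (rx ∷ rys) = All-resp-⊆ xs⊆ rx ∷ AllPairs-resp-⊆ xs⊆ rys

filter-∩ : ∀ {A : Set} {P Q R : A → Set} (P? : ∀ x → Dec (P x)) (Q? : ∀ x → Dec (Q x)) (R? : ∀ x → Dec (R x)) →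
           (∀ {x} → R x → P x × Q x) → (∀ {x} → P x → Q x → R x) →
           ∀ xs → filter R? xs ≡ filter P? (filter Q? xs)
filter-∩ P? Q? R? to from []       = refl
filter-∩ P? Q? R? to from (x ∷ xs) with Q? x
... | no ¬q = trans (filter-reject R? (¬q ∘ proj₂ ∘ to)) (filter-∩ P? Q? R? to from xs)
... | yes q with P? x
...   | yes p = trans (filter-accept R? (from p q)) (cong (x ∷_) (filter-∩ P? Q? R? to from xs))
...   | no ¬p = trans (filter-reject R? (¬p ∘ proj₁ ∘ to)) (filter-∩ P? Q? R? to from xs)

∈-oneToN⁻ : ∀ {M x} → x ∈ oneToN M → 1 ≤ x × x ≤ M
∈-oneToN⁻ x∈ with ∈-map⁻ suc x∈
... | _ , y∈ , refl = s≤s z≤n , ∈-upTo⁻ y∈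

∈-oneToN⁺ : ∀ {M x} → 1 ≤ x → x ≤ M → x ∈ oneToN M
∈-oneToN⁺ {x = suc x} _ x≤M = ∈-map⁺ suc (∈-upTo⁺ x≤M)

oneToN-unique : ∀ M → Unique (oneToN M)
oneToN-unique M = Unique.map⁺ suc-injective (Unique.upTo⁺ M)

length-oneToN : ∀ M → length (oneToN M) ≡ M
length-oneToN M = trans (length-map suc (upTo M)) (length-upTo M)

oneToN-suc : ∀ K → oneToN (suc K) ≡ oneToN K ++ suc K ∷ []
oneToN-suc K = trans (cong (map suc) (sym (upTo-∷ʳ K))) (map-++ suc (upTo K) (K ∷ []))

module _ (h : ℕ) where

  private
    evens = map (λ i → 2 * suc i) (upTo h)
    odds  = map (λ i → suc (2 * i)) (upTo (suc h))
    length-evens : length evens ≡ h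
    length-evens = trans (length-map _ (upTo h)) (length-upTo h)

  sigma-even : ∀ {t} → t < h → at (sigma (suc h)) t ≡ 2 * suc t
  sigma-even t<h = trans (at-++ˡ evens odds (subst (_ <_) (sym length-evens) t<h)) (at-map-upTo _ h t<h)

  sigma-odd : ∀ {u} → u ≤ h → at (sigma (suc h)) (h + u) ≡ suc (2 * u)
  sigma-odd {u} u≤h = trans (cong (λ l → at (sigma (suc h)) (l + u)) (sym length-evens))
                            (trans (at-++ʳ evens odds u) (at-map-upTo _ (suc h) (s≤s u≤h)))

-- Cyclic order and crossing chords

Cyclic : ℕ → ℕ → ℕ → Set
Cyclic a b c = (a < b × b < c) ⊎ (b < c × c < a) ⊎ (c < a × a < b)

cyclic-rotate : ∀ {a b c} → Cyclic a b c → Cyclic b c a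
cyclic-rotate (inj₁ (a<b , b<c))        = inj₂ (inj₂ (a<b , b<c))
cyclic-rotate (inj₂ (inj₁ (b<c , c<a))) = inj₁ (b<c , c<a)
cyclic-rotate (inj₂ (inj₂ (c<a , a<b))) = inj₂ (inj₁ (c<a , a<b))

cyclic-rotate⁻ : ∀ {a b c} → Cyclic a b c → Cyclic c a b
cyclic-rotate⁻ = cyclic-rotate ∘′ cyclic-rotate

cyclic-asym : ∀ {a b c} → Cyclic a b c → ¬ Cyclic a c b
cyclic-asym (inj₁ (a<b , b<c)) (inj₁ (_ , c<b))               = <-asym b<c c<b
cyclic-asym (inj₁ (a<b , _))   (inj₂ (inj₁ (_ , b<a)))        = <-asym a<b b<a
cyclic-asym (inj₁ (a<b , _))   (inj₂ (inj₂ (b<a , _)))        = <-asym a<b b<a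
cyclic-asym (inj₂ (inj₁ (_ , c<a))) (inj₁ (a<c , _))          = <-asym a<c c<a
cyclic-asym (inj₂ (inj₁ (b<c , _))) (inj₂ (inj₁ (c<b , _)))   = <-asym b<c c<b
cyclic-asym (inj₂ (inj₁ (_ , c<a))) (inj₂ (inj₂ (_ , a<c)))   = <-asym a<c c<a
cyclic-asym (inj₂ (inj₂ (c<a , _))) (inj₁ (a<c , _))          = <-asym a<c c<a
cyclic-asym (inj₂ (inj₂ (_ , a<b))) (inj₂ (inj₁ (_ , b<a)))   = <-asym a<b b<a
cyclic-asym (inj₂ (inj₂ (_ , a<b))) (inj₂ (inj₂ (b<a , _)))   = <-asym a<b b<a

cyclic-transˡ : ∀ {a b c d} → Cyclic a b c → Cyclic a c d → Cyclic a b d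
cyclic-transˡ (inj₁ (a<b , b<c)) (inj₁ (_ , c<d))               = inj₁ (a<b , <-trans b<c c<d)
cyclic-transˡ (inj₁ (a<b , b<c)) (inj₂ (inj₁ (c<d , d<a)))      = ⊥-elim (<-asym (<-trans a<b b<c) (<-trans c<d d<a))
cyclic-transˡ (inj₁ (a<b , _))   (inj₂ (inj₂ (d<a , _)))        = inj₂ (inj₂ (d<a , a<b))
cyclic-transˡ (inj₂ (inj₁ (_ , c<a))) (inj₁ (a<c , _))          = ⊥-elim (<-asym a<c c<a)
cyclic-transˡ (inj₂ (inj₁ (b<c , _))) (inj₂ (inj₁ (c<d , d<a))) = inj₂ (inj₁ (<-trans b<c c<d , d<a))
cyclic-transˡ (inj₂ (inj₁ (_ , c<a))) (inj₂ (inj₂ (_ , a<c)))   = ⊥-elim (<-asym a<c c<a)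
cyclic-transˡ (inj₂ (inj₂ (c<a , _))) (inj₁ (a<c , _))          = ⊥-elim (<-asym a<c c<a)
cyclic-transˡ (inj₂ (inj₂ (_ , a<b))) (inj₂ (inj₁ (_ , d<a)))   = inj₂ (inj₂ (d<a , a<b))
cyclic-transˡ (inj₂ (inj₂ (_ , a<b))) (inj₂ (inj₂ (d<a , _)))   = inj₂ (inj₂ (d<a , a<b))

cyclic-transʳ : ∀ {a b c d} → Cyclic a b c → Cyclic a c d → Cyclic b c d
cyclic-transʳ (inj₁ (_ , b<c))   (inj₁ (_ , c<d))               = inj₁ (b<c , c<d)
cyclic-transʳ (inj₁ (a<b , b<c)) (inj₂ (inj₁ (c<d , d<a)))      = ⊥-elim (<-asym (<-trans a<b b<c) (<-trans c<d d<a))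
cyclic-transʳ (inj₁ (a<b , b<c)) (inj₂ (inj₂ (d<a , _)))        = inj₂ (inj₂ (<-trans d<a a<b , b<c))
cyclic-transʳ (inj₂ (inj₁ (_ , c<a))) (inj₁ (a<c , _))          = ⊥-elim (<-asym a<c c<a)
cyclic-transʳ (inj₂ (inj₁ (b<c , _))) (inj₂ (inj₁ (c<d , _)))   = inj₁ (b<c , c<d)
cyclic-transʳ (inj₂ (inj₁ (_ , c<a))) (inj₂ (inj₂ (_ , a<c)))   = ⊥-elim (<-asym a<c c<a)
cyclic-transʳ (inj₂ (inj₂ (c<a , _))) (inj₁ (a<c , _))          = ⊥-elim (<-asym a<c c<a)
cyclic-transʳ (inj₂ (inj₂ (_ , a<b))) (inj₂ (inj₁ (c<d , d<a))) = inj₂ (inj₁ (c<d , <-trans d<a a<b))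
cyclic-transʳ (inj₂ (inj₂ (c<a , _))) (inj₂ (inj₂ (_ , a<c)))   = ⊥-elim (<-asym a<c c<a)

-- The chord {p , q} separates u from v on the circle.
Crosses : ℕ → ℕ → ℕ → ℕ → Set
Crosses p q u v = (Cyclic p u q × Cyclic q v p) ⊎ (Cyclic p v q × Cyclic q u p)

crosses-other-side : ∀ {p q u v} → Crosses p q u v → Cyclic p u q → Cyclic q v p
crosses-other-side (inj₁ (_ , qvp)) _   = qvp
crosses-other-side (inj₂ (_ , qup)) puq = ⊥-elim (cyclic-asym qup (cyclic-rotate⁻ puq))

crosses-flipˡ : ∀ {p q u v} → Crosses p q u v → Crosses q p u v
crosses-flipˡ (inj₁ (puq , qvp)) = inj₂ (qvp , puq)
crosses-flipˡ (inj₂ (pvq , qup)) = inj₁ (qup , pvq)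

crosses-flipʳ : ∀ {p q u v} → Crosses p q u v → Crosses p q v u
crosses-flipʳ (inj₁ (puq , qvp)) = inj₂ (puq , qvp)
crosses-flipʳ (inj₂ (pvq , qup)) = inj₁ (pvq , qup)

crosses-sym : ∀ {p q u v} → Crosses p q u v → Crosses u v p q
crosses-sym (inj₁ (puq , qvp)) = let pqv = cyclic-rotate⁻ qvp in
  inj₂ (cyclic-transʳ puq pqv , cyclic-rotate⁻ (cyclic-transˡ puq pqv))
crosses-sym (inj₂ (pvq , qup)) = let pqu = cyclic-rotate⁻ qup in
  inj₁ (cyclic-rotate⁻ (cyclic-transˡ pvq pqu) , cyclic-transʳ pvq pqu)

<-crosses : ∀ {x₁ x₂ x₃ x₄} → x₁ < x₂ → x₂ < x₃ → x₃ < x₄ → Crosses x₁ x₃ x₂ x₄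
<-crosses x₁<x₂ x₂<x₃ x₃<x₄ = inj₁ (inj₁ (x₁<x₂ , x₂<x₃) , inj₂ (inj₂ (<-trans x₁<x₂ x₂<x₃ , x₃<x₄)))

-- In the three lemmas below the points a, x, c, b lie on the circle in this cyclic order.
module _ {a b c x : ℕ} (acb : Cyclic a c b) (axc : Cyclic a x c) where

  ¬crosses-both : ∀ {y} → Crosses a b x y → ¬ Crosses b c x y
  ¬crosses-both ab bc =
    cyclic-asym (cyclic-transˡ (crosses-other-side ab (cyclic-transˡ axc acb)) (cyclic-rotate⁻ acb))
                (cyclic-rotate⁻ (crosses-other-side bc (cyclic-rotate⁻ (cyclic-transʳ axc acb))))

  ¬crosses-inner : ¬ Crosses a b c x
  ¬crosses-inner ab = cyclic-asym (cyclic-transˡ axc acb) (cyclic-rotate⁻ (crosses-other-side ab acb))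

  ¬crosses-outer : ¬ Crosses x a b c
  ¬crosses-outer xa = cyclic-asym axc (crosses-other-side xa (cyclic-rotate (cyclic-transˡ axc acb)))

-- Pointer words read through positions

data Alternating (K L : ℕ → Set) : Set where
  alternating : ∀ {k₁ k₂ k₃ k₄} → k₁ < k₂ → k₂ < k₃ → k₃ < k₄ →
                K k₁ → L k₂ → K k₃ → L k₄ → Alternating K L

-- Number the letters of the unfiltered pointer word L(π(1)) R(π(1)) ⋯ consecutively from 0.
-- If c sits at index a and c + 1 at index b, the pointer (c, c+1) occurs as the left pointer
-- of c + 1, with key 2b, and as the right pointer of c, with key 2a + 1.
PointerKey : ℕ → ℕ → ℕ → Set
PointerKey a b k = k ≡ 2 * b ⊎ k ≡ suc (2 * a)

private
  2*-cancel-< : ∀ {x y} → 2 * x < 2 * y → x < y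
  2*-cancel-< {x} {y} = *-cancelˡ-< 2 x y

  2*<1+2*⇒≤ : ∀ {x y} → 2 * x < suc (2 * y) → x ≤ y
  2*<1+2*⇒≤ (s≤s p) = *-cancelˡ-≤ 2 p

  1+2*-cancel-< : ∀ {x y} → suc (2 * x) < suc (2 * y) → x < y
  1+2*-cancel-< (s≤s p) = 2*-cancel-< p

  1+2*<2*⇒< : ∀ {x y} → suc (2 * x) < 2 * y → x < y
  1+2*<2*⇒< p = 2*-cancel-< (<-trans (n<1+n _) p)

  ¬<-≡ : ∀ {k₁ k₂ k₃} → k₁ < k₂ → k₂ < k₃ → k₁ ≢ k₃
  ¬<-≡ p q e = <-irrefl e (<-trans p q)

  PosKey : ℕ → ℕ → Set
  PosKey x k = k ≡ 2 * x ⊎ k ≡ suc (2 * x)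

  posKey-< : ∀ {x y k k′} → PosKey x k → PosKey y k′ → k < k′ → x ≢ y → x < y
  posKey-< (inj₁ refl) (inj₁ refl) p _  = 2*-cancel-< p
  posKey-< (inj₁ refl) (inj₂ refl) p ne = ≤∧≢⇒< (2*<1+2*⇒≤ p) ne
  posKey-< (inj₂ refl) (inj₁ refl) p _  = 1+2*<2*⇒< p
  posKey-< (inj₂ refl) (inj₂ refl) p _  = 1+2*-cancel-< p

adjacent-alternating⇒cyclic : ∀ {a b e} →
  Alternating (PointerKey a b) (PointerKey b e) → Cyclic a e b
adjacent-alternating⇒cyclic (alternating p q _ (inj₁ refl) _ (inj₁ refl) _) = ⊥-elim (¬<-≡ p q refl)
adjacent-alternating⇒cyclic (alternating p q _ (inj₂ refl) _ (inj₂ refl) _) = ⊥-elim (¬<-≡ p q refl)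
adjacent-alternating⇒cyclic (alternating _ q r _ (inj₁ refl) _ (inj₁ refl)) = ⊥-elim (¬<-≡ q r refl)
adjacent-alternating⇒cyclic (alternating _ q r _ (inj₂ refl) _ (inj₂ refl)) = ⊥-elim (¬<-≡ q r refl)
adjacent-alternating⇒cyclic {a} {b} (alternating p q r (inj₁ refl) (inj₁ refl) (inj₂ refl) (inj₂ refl)) =
  ⊥-elim (<-irrefl refl (<-≤-trans (1+2*-cancel-< {a} {b} r) (2*<1+2*⇒≤ {b} {a} (<-trans p q))))
adjacent-alternating⇒cyclic {a} {b} {e} (alternating _ q r (inj₁ refl) (inj₂ refl) (inj₂ refl) (inj₁ refl)) =
  inj₂ (inj₂ (1+2*-cancel-< {b} {a} q , 1+2*<2*⇒< {a} {e} r))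
adjacent-alternating⇒cyclic {a} {b} {e} (alternating p q _ (inj₂ refl) (inj₁ refl) (inj₁ refl) (inj₂ refl)) =
  inj₁ (1+2*<2*⇒< {a} {e} p , 2*-cancel-< {e} {b} q)
adjacent-alternating⇒cyclic (alternating _ q _ (inj₂ refl) (inj₂ refl) (inj₁ refl) (inj₁ refl)) =
  ⊥-elim (<-asym q (n<1+n _))

adjacent-alternating⇒cyclic′ : ∀ {a b e} →
  Alternating (PointerKey b e) (PointerKey a b) → Cyclic a e b
adjacent-alternating⇒cyclic′ (alternating p q _ (inj₁ refl) _ (inj₁ refl) _) = ⊥-elim (¬<-≡ p q refl)
adjacent-alternating⇒cyclic′ (alternating p q _ (inj₂ refl) _ (inj₂ refl) _) = ⊥-elim (¬<-≡ p q refl)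
adjacent-alternating⇒cyclic′ (alternating _ q r _ (inj₁ refl) _ (inj₁ refl)) = ⊥-elim (¬<-≡ q r refl)
adjacent-alternating⇒cyclic′ (alternating _ q r _ (inj₂ refl) _ (inj₂ refl)) = ⊥-elim (¬<-≡ q r refl)
adjacent-alternating⇒cyclic′ {a} {b} {e} (alternating p _ r (inj₁ refl) (inj₁ refl) (inj₂ refl) (inj₂ refl)) =
  inj₂ (inj₁ (2*-cancel-< {e} {b} p , 1+2*-cancel-< {b} {a} r))
adjacent-alternating⇒cyclic′ (alternating _ _ r (inj₁ refl) (inj₂ refl) (inj₂ refl) (inj₁ refl)) =
  ⊥-elim (<-asym r (n<1+n _))
adjacent-alternating⇒cyclic′ (alternating p _ _ (inj₂ refl) (inj₁ refl) (inj₁ refl) (inj₂ refl)) =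
  ⊥-elim (<-asym p (n<1+n _))
adjacent-alternating⇒cyclic′ {a} {b} {e} (alternating p q r (inj₂ refl) (inj₂ refl) (inj₁ refl) (inj₁ refl)) =
  ⊥-elim (<-asym (<-trans (1+2*-cancel-< {b} {a} p) (1+2*<2*⇒< {a} {e} q)) (2*-cancel-< {e} {b} r))

module _ {a b e f : ℕ} (a≢e : a ≢ e) (a≢f : a ≢ f) (b≢e : b ≢ e) (b≢f : b ≢ f) where

  alternating⇒crosses : Alternating (PointerKey a b) (PointerKey e f) → Crosses a b e f
  alternating⇒crosses (alternating p q _ (inj₁ refl) _ (inj₁ refl) _) = ⊥-elim (¬<-≡ p q refl)
  alternating⇒crosses (alternating p q _ (inj₂ refl) _ (inj₂ refl) _) = ⊥-elim (¬<-≡ p q refl)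
  alternating⇒crosses (alternating _ q r _ (inj₁ refl) _ (inj₁ refl)) = ⊥-elim (¬<-≡ q r refl)
  alternating⇒crosses (alternating _ q r _ (inj₂ refl) _ (inj₂ refl)) = ⊥-elim (¬<-≡ q r refl)
  alternating⇒crosses (alternating p q r (inj₁ refl) (inj₁ refl) (inj₂ refl) (inj₂ refl)) =
    crosses-flipʳ (crosses-flipˡ (<-crosses (posKey-< (inj₁ refl) (inj₁ refl) p b≢f)
      (posKey-< (inj₁ refl) (inj₂ refl) q (a≢f ∘′ sym)) (posKey-< (inj₂ refl) (inj₂ refl) r a≢e)))
  alternating⇒crosses (alternating p q r (inj₁ refl) (inj₂ refl) (inj₂ refl) (inj₁ refl)) =
    crosses-flipˡ (<-crosses (posKey-< (inj₁ refl) (inj₂ refl) p b≢e)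
      (posKey-< (inj₂ refl) (inj₂ refl) q (a≢e ∘′ sym)) (posKey-< (inj₂ refl) (inj₁ refl) r a≢f))
  alternating⇒crosses (alternating p q r (inj₂ refl) (inj₁ refl) (inj₁ refl) (inj₂ refl)) =
    crosses-flipʳ (<-crosses (posKey-< (inj₂ refl) (inj₁ refl) p a≢f)
      (posKey-< (inj₁ refl) (inj₁ refl) q (b≢f ∘′ sym)) (posKey-< (inj₁ refl) (inj₂ refl) r b≢e))
  alternating⇒crosses (alternating p q r (inj₂ refl) (inj₂ refl) (inj₁ refl) (inj₁ refl)) =
    <-crosses (posKey-< (inj₂ refl) (inj₂ refl) p a≢e)
      (posKey-< (inj₂ refl) (inj₁ refl) q (b≢e ∘′ sym)) (posKey-< (inj₁ refl) (inj₁ refl) r b≢f)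

alternating⇒crosses′ : ∀ {a b e f} → a ≢ e → a ≢ f → b ≢ e → b ≢ f →
  Alternating (PointerKey e f) (PointerKey a b) → Crosses a b e f
alternating⇒crosses′ a≢e a≢f b≢e b≢f alt =
  crosses-sym (alternating⇒crosses (a≢e ∘′ sym) (b≢e ∘′ sym) (a≢f ∘′ sym) (b≢f ∘′ sym) alt)

isPointer? : (N c : ℕ) → Dec (1 ≤ c × c < N)
isPointer? N c = (1 ≤? c) ×-dec (c <? N)

-- The pointer word of xs, each letter tagged with its key when the first entry of xs has index i.
keyedBlock : ℕ → ℕ → List (ℕ × ℕ)
keyedBlock i x = (x ∸ 1 , 2 * i) ∷ (x , suc (2 * i)) ∷ []

keyedPointerWord : ℕ → ℕ → List ℕ → List (ℕ × ℕ)
keyedPointerWord N i []       = []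
keyedPointerWord N i (x ∷ xs) =
  filter (isPointer? N ∘ proj₁) (keyedBlock i x) ++ keyedPointerWord N (suc i) xs

forget-keys : ∀ N i xs → map proj₁ (keyedPointerWord N i xs) ≡ pointerWord N xs
forget-keys N i []       = refl
forget-keys N i (x ∷ xs) =
  trans (map-++ proj₁ (filter (isPointer? N ∘ proj₁) (keyedBlock i x)) (keyedPointerWord N (suc i) xs))
        (cong₂ _++_ (map-filter-∘ proj₁ (isPointer? N) (keyedBlock i x)) (forget-keys N (suc i) xs))

Keyed : ℕ → List ℕ → ℕ × ℕ → Set
Keyed i xs (c , k) = Σ ℕ λ j → j < length xs ×
  ((k ≡ 2 * (i + j) × at xs j ≡ suc c) ⊎ (k ≡ suc (2 * (i + j)) × at xs j ≡ c))

keys-keyed : ∀ N i xs → All (Keyed i xs) (keyedPointerWord N i xs)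
keys-keyed N i []       = []
keys-keyed N i (x ∷ xs) =
  All.++⁺ (All-filter-guarded P? (left x ∷ right ∷ []))
          (All.map shift (keys-keyed N (suc i) xs))
  where
  P? = isPointer? N ∘ proj₁
  left : ∀ x → 1 ≤ x ∸ 1 × x ∸ 1 < N → Keyed i (x ∷ xs) (x ∸ 1 , 2 * i)
  left (suc x) _ = 0 , s≤s z≤n , inj₁ (cong (2 *_) (sym (+-identityʳ i)) , refl)
  right : 1 ≤ x × x < N → Keyed i (x ∷ xs) (x , suc (2 * i))
  right _ = 0 , s≤s z≤n , inj₂ (cong (suc ∘ (2 *_)) (sym (+-identityʳ i)) , refl)
  shift : ∀ {e} → Keyed (suc i) xs e → Keyed i (x ∷ xs) e
  shift (j , j< , inj₁ (k≡ , eq)) = suc j , s≤s j< , inj₁ (trans k≡ (cong (2 *_) (sym (+-suc i j))) , eq)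
  shift (j , j< , inj₂ (k≡ , eq)) = suc j , s≤s j< , inj₂ (trans k≡ (cong (suc ∘ (2 *_)) (sym (+-suc i j))) , eq)

keyed⇒≥ : ∀ {i xs e} → Keyed i xs e → 2 * i ≤ proj₂ e
keyed⇒≥ {i} (j , _ , inj₁ (refl , _)) = *-monoʳ-≤ 2 (m≤m+n i j)
keyed⇒≥ {i} (j , _ , inj₂ (refl , _)) = m≤n⇒m≤1+n (*-monoʳ-≤ 2 (m≤m+n i j))

_<ᵏ_ : ℕ × ℕ → ℕ × ℕ → Set
e <ᵏ e′ = proj₂ e < proj₂ e′

keys-increasing : ∀ N i xs → AllPairs _<ᵏ_ (keyedPointerWord N i xs)
keys-increasing N i []       = []
keys-increasing N i (x ∷ xs) =
  AllPairs.++⁺ (AllPairs.filter⁺ P? {keyedBlock i x} ((n<1+n _ ∷ []) ∷ [] ∷ []))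
               (keys-increasing N (suc i) xs)
               (All.filter⁺ P? {xs = keyedBlock i x} (later (≤-trans (n≤1+n _)) ∷ later (λ p → p) ∷ []))
  where
  P? = isPointer? N ∘ proj₁
  2i+2≡ : 2 * suc i ≡ suc (suc (2 * i))
  2i+2≡ = *-suc 2 i
  later : ∀ {k} → (∀ {k′} → suc (suc (2 * i)) ≤ k′ → suc k ≤ k′) →
          All (λ e → k < proj₂ e) (keyedPointerWord N (suc i) xs)
  later k< = All.map (λ {e} ke → k< (subst (_≤ proj₂ e) 2i+2≡ (keyed⇒≥ {suc i} {xs} ke))) (keys-keyed N (suc i) xs)

module Positions {M : ℕ} {π : List ℕ} (π-perm : IsPerm M π) where

  length-π : length π ≡ M
  length-π = trans (↭-length π-perm) (length-oneToN M)

  private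
    <M⇒<length : ∀ {i} → i < M → i < length π
    <M⇒<length = subst (_ <_) (sym length-π)

  entry-bounds : ∀ {i} → i < M → 1 ≤ at π i × at π i ≤ M
  entry-bounds i<M = ∈-oneToN⁻ (∈-resp-↭ π-perm (at-∈ π (<M⇒<length i<M)))

  entries-injective : ∀ {i j} → i < M → j < M → at π i ≡ at π j → i ≡ j
  entries-injective i<M j<M =
    at-injective (Unique-resp-↭ (setoid ℕ) (↭⇒↭ₛ (↭-sym π-perm)) (oneToN-unique M))
                 (<M⇒<length i<M) (<M⇒<length j<M)

  private
    occurrence : ∀ {v} → 1 ≤ v → v ≤ M → Σ ℕ λ i → i < M × at π i ≡ v
    occurrence 1≤v v≤M with ∈⇒at π (∈-resp-↭ (↭-sym π-perm) (∈-oneToN⁺ 1≤v v≤M))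
    ... | i , i< , eq = i , subst (i <_) length-π i< , eq

  -- junk value 0 when v is out of range
  pos : ℕ → ℕ
  pos v with 1 ≤? v | v ≤? M
  ... | yes 1≤v | yes v≤M = proj₁ (occurrence 1≤v v≤M)
  ... | _       | _       = 0

  pos-spec : ∀ {v} → 1 ≤ v → v ≤ M → pos v < M × at π (pos v) ≡ v
  pos-spec {v} 1≤v v≤M with 1 ≤? v | v ≤? M
  ... | yes 1≤v′ | yes v≤M′ = proj₂ (occurrence 1≤v′ v≤M′)
  ... | no 1≰v   | _        = ⊥-elim (1≰v 1≤v)
  ... | yes _    | no v≰M   = ⊥-elim (v≰M v≤M)

  pos-unique : ∀ {i v} → i < M → at π i ≡ v → pos v ≡ i
  pos-unique i<M refl with entry-bounds i<M
  ... | 1≤v , v≤M = entries-injective (proj₁ (pos-spec 1≤v v≤M)) i<M (proj₂ (pos-spec 1≤v v≤M))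

  pos-injective : ∀ {u v} → 1 ≤ u → u ≤ M → 1 ≤ v → v ≤ M → pos u ≡ pos v → u ≡ v
  pos-injective 1≤u u≤M 1≤v v≤M eq =
    trans (sym (proj₂ (pos-spec 1≤u u≤M))) (trans (cong (at π) eq) (proj₂ (pos-spec 1≤v v≤M)))

  <⇒pos-≢ : ∀ {u v} → 1 ≤ u → v ≤ M → u < v → pos u ≢ pos v
  <⇒pos-≢ 1≤u v≤M u<v eq =
    <-irrefl (pos-injective 1≤u (≤-trans (<⇒≤ u<v) v≤M) (≤-trans 1≤u (<⇒≤ u<v)) v≤M eq) u<v

  PointerKeyOf : ℕ → ℕ → Set
  PointerKeyOf c = PointerKey (pos c) (pos (suc c))

  keyed⇒pointerKey : ∀ {c k} → 1 ≤ c → c < M → Keyed 0 π (c , k) → PointerKeyOf c k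
  keyed⇒pointerKey _ _ (j , j< , inj₁ (k≡ , eq)) =
    inj₁ (trans k≡ (cong (2 *_) (sym (pos-unique (subst (j <_) length-π j<) eq))))
  keyed⇒pointerKey _ _ (j , j< , inj₂ (k≡ , eq)) =
    inj₂ (trans k≡ (cong (suc ∘ (2 *_)) (sym (pos-unique (subst (j <_) length-π j<) eq))))

  subsequence⇒alternating : ∀ {c d} → 1 ≤ c → c < M → 1 ≤ d → d < M →
    (c ∷ d ∷ c ∷ d ∷ []) ⊆ pointerWord M π → Alternating (PointerKeyOf c) (PointerKeyOf d)
  subsequence⇒alternating {c} {d} 1≤c c<M 1≤d d<M sub
    with ⊆-map⁻ proj₁ (keyedPointerWord M 0 π) (subst (_ ⊆_) (sym (forget-keys M 0 π)) sub)
  ... | (_ , k₁) ∷ (_ , k₂) ∷ (_ , k₃) ∷ (_ , k₄) ∷ [] , sub′ , refl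
    with All-resp-⊆ sub′ (keys-keyed M 0 π) | AllPairs-resp-⊆ sub′ (keys-increasing M 0 π)
  ... | o₁ ∷ o₂ ∷ o₃ ∷ o₄ ∷ [] | (k₁<k₂ ∷ _) ∷ (k₂<k₃ ∷ _) ∷ (k₃<k₄ ∷ _) ∷ _ =
    alternating k₁<k₂ k₂<k₃ k₃<k₄ (keyed⇒pointerKey 1≤c c<M o₁) (keyed⇒pointerKey 1≤d d<M o₂)
                                  (keyed⇒pointerKey 1≤c c<M o₃) (keyed⇒pointerKey 1≤d d<M o₄)

  interleave⇒alternating : ∀ {c d} → 1 ≤ c → c < M → 1 ≤ d → d < M →
    Interleave (pointerWord M π) c d →
    Alternating (PointerKeyOf c) (PointerKeyOf d) ⊎ Alternating (PointerKeyOf d) (PointerKeyOf c)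
  interleave⇒alternating 1≤c c<M 1≤d d<M (inj₁ sub) = inj₁ (subsequence⇒alternating 1≤c c<M 1≤d d<M sub)
  interleave⇒alternating 1≤c c<M 1≤d d<M (inj₂ sub) = inj₂ (subsequence⇒alternating 1≤d d<M 1≤c c<M sub)

  adjacent-interleave⇒cyclic : ∀ {c} → 1 ≤ c → suc (suc c) ≤ M → Interleave (pointerWord M π) c (suc c) →
    Cyclic (pos c) (pos (suc (suc c))) (pos (suc c))
  adjacent-interleave⇒cyclic 1≤c c+2≤M il =
    [ adjacent-alternating⇒cyclic , adjacent-alternating⇒cyclic′ ]′
      (interleave⇒alternating 1≤c (<-trans (n<1+n _) c+2≤M) (s≤s z≤n) c+2≤M il)

  interleave⇒crosses : ∀ {c d} → 1 ≤ c → suc (suc c) ≤ d → d < M → Interleave (pointerWord M π) c d →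
    Crosses (pos c) (pos (suc c)) (pos d) (pos (suc d))
  interleave⇒crosses {c} {d} 1≤c c+2≤d d<M il =
    [ alternating⇒crosses c≢d c≢d+1 c+1≢d c+1≢d+1 , alternating⇒crosses′ c≢d c≢d+1 c+1≢d c+1≢d+1 ]′
      (interleave⇒alternating 1≤c c<M 1≤d d<M il)
    where
    c<d   = ≤-trans (n≤1+n (suc c)) c+2≤d
    c<M   = <-trans c<d d<M
    1≤d   = ≤-trans 1≤c (<⇒≤ c<d)
    c≢d     = <⇒pos-≢ 1≤c (<⇒≤ d<M) c<d
    c≢d+1   = <⇒pos-≢ 1≤c d<M (m≤n⇒m≤1+n c<d)
    c+1≢d   = <⇒pos-≢ (s≤s z≤n) (<⇒≤ d<M) c+2≤d
    c+1≢d+1 = <⇒pos-≢ (s≤s z≤n) d<M (m≤n⇒m≤1+n c+2≤d)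

-- The entry after j is j + 2

module Cycle (m : ℕ) where

  private
    M = suc m

  next : ℕ → ℕ
  next i = suc i % M

  next-< : ∀ i → next i < M
  next-< i = m%n<n (suc i) M

  next-cases : ∀ {a} → a < M → (suc a < M × next a ≡ suc a) ⊎ (a ≡ m × next a ≡ 0)
  next-cases a<M with m≤n⇒m<n∨m≡n a<M
  ... | inj₁ a+1<M = inj₁ (a+1<M , m<n⇒m%n≡m a+1<M)
  ... | inj₂ a+1≡M = inj₂ (suc-injective a+1≡M , trans (cong (_% M) a+1≡M) (n%n≡0 M))

  next-cyclic : ∀ {a z} → a < M → z < M → z ≢ a → z ≢ next a → Cyclic a (next a) z
  next-cyclic {a} {z} a<M z<M z≢a z≢next with next-cases a<M
  ... | inj₂ (refl , eq) rewrite eq = inj₂ (inj₁ (≤∧≢⇒< z≤n (z≢next ∘′ sym) , ≤∧≢⇒< (≤-pred z<M) z≢a))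
  ... | inj₁ (_ , eq) rewrite eq with <-cmp z a
  ...   | tri< z<a _ _ = inj₂ (inj₂ (z<a , n<1+n a))
  ...   | tri≈ _ z≡a _ = ⊥-elim (z≢a z≡a)
  ...   | tri> _ _ a<z = inj₁ (n<1+n a , ≤∧≢⇒< a<z (z≢next ∘′ sym))

  next-≢ : ∀ {a} → 1 ≤ m → a < M → next a ≢ a
  next-≢ {a} 1≤m a<M eq with next-cases a<M
  ... | inj₁ (_ , eq′)    = <-irrefl (trans (sym eq) eq′) (n<1+n a)
  ... | inj₂ (refl , eq′) = <-irrefl (sym (trans (sym eq) eq′)) 1≤m

  next-injective : ∀ {x y} → x < M → y < M → next x ≡ next y → x ≡ y
  next-injective x<M y<M eq with next-cases x<M | next-cases y<M
  ... | inj₁ (_ , ex)   | inj₁ (_ , ey)   = suc-injective (trans (sym ex) (trans eq ey))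
  ... | inj₁ (_ , ex)   | inj₂ (_ , ey)   with () ← trans (sym ex) (trans eq ey)
  ... | inj₂ (_ , ex)   | inj₁ (_ , ey)   with () ← trans (sym ey) (trans (sym eq) ex)
  ... | inj₂ (x≡m , _)  | inj₂ (y≡m , _)  = trans x≡m (sym y≡m)

  +-%-absorbʳ : ∀ a x → (a + x % M) % M ≡ (a + x) % M
  +-%-absorbʳ a x = begin
    (a + x % M) % M             ≡⟨ %-distribˡ-+ a (x % M) M ⟩
    (a % M + x % M % M) % M     ≡⟨ cong (λ r → (a % M + r) % M) (m%n%n≡m%n x M) ⟩
    (a % M + x % M) % M         ≡⟨ %-distribˡ-+ a x M ⟨
    (a + x) % M                 ∎
    where open ≡-Reasoning

  +-suc-% : ∀ a t → (a + suc t) % M ≡ next ((a + t) % M)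
  +-suc-% a t = trans (cong (_% M) (+-suc a t)) (sym (+-%-absorbʳ 1 (a + t)))

  +-%-≢ : ∀ {a d} → a < M → 0 < d → d < M → (a + d) % M ≢ a
  +-%-≢ {a} {d} a<M 0<d d<M eq with a + d <? M
  ... | yes a+d<M = <-irrefl (sym (+-cancelˡ-≡ a d 0 (trans (trans (sym (m<n⇒m%n≡m a+d<M)) eq) (sym (+-identityʳ a))))) 0<d
  ... | no a+d≮M  = <-irrefl (+-cancelˡ-≡ a d M a+d≡a+M) d<M
    where
    M≤a+d : M ≤ a + d
    M≤a+d = ≮⇒≥ a+d≮M
    a+d∸M<M : a + d ∸ M < M
    a+d∸M<M = +-cancelˡ-< M (a + d ∸ M) M (subst (_< M + M) (sym (m+[n∸m]≡n M≤a+d)) (+-mono-< a<M d<M))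
    a+d∸M≡a : a + d ∸ M ≡ a
    a+d∸M≡a = trans (sym (m<n⇒m%n≡m a+d∸M<M)) (trans (m≤n⇒[n∸m]%m≡n%m M≤a+d) eq)
    a+d≡a+M : a + d ≡ a + M
    a+d≡a+M = trans (sym (m∸n+n≡m M≤a+d)) (cong (_+ M) a+d∸M≡a)

module Successor {m : ℕ} {π : List ℕ} (π-perm : IsPerm (suc m) π)
  (all-interleave : ∀ {c d} → 1 ≤ c → c < d → d < suc m → Interleave (pointerWord (suc m) π) c d) where

  open Positions π-perm public
  open Cycle m public

  private
    M = suc m

  crossing : ∀ {c d} → 1 ≤ c → suc (suc c) ≤ d → d < M → Crosses (pos c) (pos (suc c)) (pos d) (pos (suc d))
  crossing 1≤c c+2≤d d<M = interleave⇒crosses 1≤c c+2≤d d<M (all-interleave 1≤c (≤-trans (n≤1+n _) c+2≤d) d<M)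

  adjacent : ∀ {c} → 1 ≤ c → suc (suc c) ≤ M → Cyclic (pos c) (pos (suc (suc c))) (pos (suc c))
  adjacent 1≤c c+2≤M = adjacent-interleave⇒cyclic 1≤c c+2≤M (all-interleave 1≤c (n<1+n _) c+2≤M)

  -- A value v ≠ j+2 after j is excluded by the chord of a pointer p ∈ {v−1, v} that is far
  -- from j and j+1; the few v for which no such pointer exists are handled one by one.
  module _ {j : ℕ} (1≤j : 1 ≤ j) (j+2≤M : suc (suc j) ≤ M) where

    private
      a = pos j
      b = pos (suc j)
      c = pos (suc (suc j))
      acb : Cyclic a c b
      acb = adjacent 1≤j j+2≤M
      j<M : j < M
      j<M = ≤-trans (n≤1+n _) j+2≤M
      a<M : a < M
      a<M = proj₁ (pos-spec 1≤j (<⇒≤ j<M))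

    chord-crosses-both : ∀ {p} → 1 ≤ p → p < M → suc (suc p) ≤ j ⊎ suc (suc (suc j)) ≤ p →
      Crosses a b (pos p) (pos (suc p)) × Crosses b c (pos p) (pos (suc p))
    chord-crosses-both 1≤p _ (inj₁ p+2≤j) =
      crosses-sym (crossing 1≤p p+2≤j j<M) , crosses-sym (crossing 1≤p (m≤n⇒m≤1+n p+2≤j) j+2≤M)
    chord-crosses-both _ p<M (inj₂ j+3≤p) =
      crossing 1≤j (≤-trans (n≤1+n _) j+3≤p) p<M , crossing (s≤s z≤n) j+3≤p p<M

    chord-avoids : ∀ {x p} → Cyclic a x c → 1 ≤ p → p < M → suc (suc p) ≤ j ⊎ suc (suc (suc j)) ≤ p →
      pos p ≢ x × pos (suc p) ≢ x
    chord-avoids {x} axc 1≤p p<M far =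
      (λ eq → ¬crosses-both acb (subst (λ y → Cyclic a y c) (sym eq) axc) ab bc) ,
      (λ eq → ¬crosses-both acb (subst (λ y → Cyclic a y c) (sym eq) axc) (crosses-flipʳ ab) (crosses-flipʳ bc))
      where
      ab = proj₁ (chord-crosses-both 1≤p p<M far)
      bc = proj₂ (chord-crosses-both 1≤p p<M far)

    ¬value-below : ∀ {v} → 1 ≤ v → v < j → pos v ≡ next a → Cyclic a (next a) c → ⊥
    ¬value-below {v} 1≤v v<j pv axc with suc (suc v) ≤? j
    ... | yes v+2≤j = proj₁ (chord-avoids axc 1≤v (<-trans v<j j<M) (inj₁ v+2≤j)) pv
    ... | no v+2≰j = below-by-one 1≤v v+1≡j pv
      where
      v+1≡j : suc v ≡ j
      v+1≡j = ≤-antisym v<j (≤-pred (≰⇒> v+2≰j))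
      below-by-one : ∀ {v} → 1 ≤ v → suc v ≡ j → pos v ≡ next a → ⊥
      below-by-one {1} _ 2≡j p1 = ¬crosses-outer acb axc
        (subst (λ y → Crosses y a b c) p1
          (subst (λ t → Crosses (pos 1) (pos t) (pos (suc t)) (pos (suc (suc t)))) 2≡j
            (crossing (s≤s z≤n) ≤-refl (subst (λ t → suc (suc t) ≤ M) (sym 2≡j) j+2≤M))))
      below-by-one {suc (suc v)} _ v+1≡j pv =
        proj₂ (chord-avoids axc (s≤s z≤n) (≤-trans (n≤1+n _) (≤-trans (≤-reflexive v+1≡j) (<⇒≤ j<M)))
                            (inj₁ (≤-reflexive v+1≡j))) pv

    ¬value-above : ∀ {v} → j < v → v ≤ M → v ≢ suc (suc j) → pos v ≡ next a → Cyclic a (next a) c → ⊥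
    ¬value-above {v} j<v v≤M v≢j+2 pv axc with v ≟ suc j
    ... | yes refl = cyclic-asym (subst (λ y → Cyclic a y c) (sym pv) axc) acb
    ... | no v≢j+1 with v <? M
    ...   | yes v<M = proj₁ (chord-avoids axc (≤-trans (s≤s z≤n) j<v) v<M (inj₂ j+3≤v)) pv
      where
      j+3≤v = ≤∧≢⇒< (≤∧≢⇒< j<v (v≢j+1 ∘′ sym)) (v≢j+2 ∘′ sym)
    ...   | no v≮M = last (≤-antisym v≤M (≮⇒≥ v≮M)) pv (≤∧≢⇒< (≤∧≢⇒< j<v (v≢j+1 ∘′ sym)) (v≢j+2 ∘′ sym))
      where
      last : ∀ {v} → v ≡ M → pos v ≡ next a → suc (suc (suc j)) ≤ v → ⊥
      last refl pM j+3≤M with suc (suc (suc j)) ≤? m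
      ... | yes j+3≤m = proj₂ (chord-avoids axc (≤-trans (s≤s z≤n) j+3≤m) ≤-refl (inj₂ j+3≤m)) pM
      ... | no j+3≰m = ¬crosses-inner acb axc
        (subst (Crosses a b c) (trans (cong (pos ∘ suc) m≡j+2) pM) (crossing 1≤j ≤-refl j+3≤M))
        where
        m≡j+2 : suc (suc j) ≡ m
        m≡j+2 = ≤-antisym (≤-pred j+3≤M) (≤-pred (≰⇒> j+3≰m))

    at-next-pos : at π (next a) ≡ suc (suc j)
    at-next-pos with at π (next a) ≟ suc (suc j)
    ... | yes eq = eq
    ... | no v≢j+2 = ⊥-elim (¬value (entry-bounds (next-< a)) (pos-unique (next-< a) refl) v≢j+2)
      where
      ¬value : ∀ {v} → 1 ≤ v × v ≤ M → pos v ≡ next a → v ≢ suc (suc j) → ⊥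
      ¬value {v} (1≤v , v≤M) pv v≢j+2 = case-on-v (<-cmp v j)
        where
        c≢a : c ≢ a
        c≢a eq = <⇒pos-≢ 1≤j j+2≤M (m≤n⇒m≤1+n (n<1+n j)) (sym eq)
        c≢next : c ≢ next a
        c≢next eq = v≢j+2 (pos-injective 1≤v v≤M (s≤s z≤n) j+2≤M (trans pv (sym eq)))
        axc : Cyclic a (next a) c
        axc = next-cyclic a<M (proj₁ (pos-spec (s≤s z≤n) j+2≤M)) c≢a c≢next
        case-on-v : Tri (v < j) (v ≡ j) (j < v) → ⊥
        case-on-v (tri< v<j _ _)  = ¬value-below 1≤v v<j pv axc
        case-on-v (tri≈ _ v≡j _)  = next-≢ (≤-trans 1≤j (≤-pred (<⇒≤ j+2≤M))) a<M (trans (sym pv) (cong pos v≡j))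
        case-on-v (tri> _ _ j<v)  = ¬value-above j<v v≤M v≢j+2 pv axc

module CyclicShift {k : ℕ} {π : List ℕ} (π-perm : IsPerm (suc (2 * suc k)) π)
  (all-interleave : ∀ {c d} → 1 ≤ c → c < d → d < suc (2 * suc k) →
                    Interleave (pointerWord (suc (2 * suc k)) π) c d) where

  open Successor π-perm all-interleave

  private
    h = suc k
    M = suc (2 * h)
    2≤M : 2 ≤ M
    2≤M = s≤s (s≤s z≤n)

  a : ℕ
  a = pos 2

  a<M : a < M
  a<M = proj₁ (pos-spec (s≤s z≤n) 2≤M)

  shift : ℕ → ℕ
  shift t = (a + t) % M

  two-steps : ∀ {t j} → 1 ≤ j → suc (suc j) ≤ M → at π (shift t) ≡ j → at π (shift (suc t)) ≡ suc (suc j)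
  two-steps {t} {j} 1≤j j+2≤M eq = begin
    at π (shift (suc t))     ≡⟨ cong (at π) (+-suc-% a t) ⟩
    at π (next (shift t))    ≡⟨ cong (at π ∘ next) (pos-unique (m%n<n (a + t) M) eq) ⟨
    at π (next (pos j))      ≡⟨ at-next-pos 1≤j j+2≤M ⟩
    suc (suc j)              ∎
    where open ≡-Reasoning

  shift-evens : ∀ {t} → t < h → at π (shift t) ≡ 2 * suc t
  shift-evens {zero}  _       =
    trans (cong (at π) (trans (cong (_% M) (+-identityʳ a)) (m<n⇒m%n≡m a<M))) (proj₂ (pos-spec (s≤s z≤n) 2≤M))
  shift-evens {suc t} t+1<h   =
    trans (two-steps (s≤s z≤n) bound (shift-evens (<-trans (n<1+n t) t+1<h))) (sym (*-suc 2 (suc t)))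
    where
    bound : suc (suc (2 * suc t)) ≤ M
    bound = m≤n⇒m≤1+n (subst (_≤ 2 * h) (*-suc 2 (suc t)) (*-monoʳ-≤ 2 t+1<h))

  one-after-evens : at π (shift h) ≡ 1
  one-after-evens = value-is-1 (entry-bounds (m%n<n (a + h) M)) refl
    where
    value-is-1 : ∀ {w} → 1 ≤ w × w ≤ M → at π (shift h) ≡ w → w ≡ 1
    value-is-1 {1} _ _ = refl
    value-is-1 {2} _ eq = ⊥-elim (+-%-≢ a<M (s≤s z≤n) (s≤s (m≤m+n h _)) (sym (pos-unique (m%n<n (a + h) M) eq)))
    value-is-1 {suc (suc (suc w))} (_ , w+3≤M) eq = ⊥-elim (<-irrefl refl (subst (λ z → suc (suc z) ≤ M) w+1≡2h w+3≤M))
      where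
      w+1≤M = ≤-trans (n≤1+n _) (≤-trans (n≤1+n _) w+3≤M)
      next-pos≡ : next (pos (suc w)) ≡ next (shift k)
      next-pos≡ = trans (entries-injective (next-< (pos (suc w))) (m%n<n (a + h) M) (trans (at-next-pos {suc w} (s≤s z≤n) w+3≤M) (sym eq)))
                        (+-suc-% a k)
      pos≡ : pos (suc w) ≡ pos (2 * h)
      pos≡ = trans (next-injective (proj₁ (pos-spec (s≤s z≤n) w+1≤M)) (m%n<n (a + k) M) next-pos≡)
                   (sym (pos-unique (m%n<n (a + k) M) (shift-evens (n<1+n k))))
      w+1≡2h : suc w ≡ 2 * h
      w+1≡2h = pos-injective (s≤s z≤n) w+1≤M (≤-trans (s≤s z≤n) (m≤m+n h _)) (n≤1+n _) pos≡

  shift-odds : ∀ {u} → u ≤ h → at π (shift (h + u)) ≡ suc (2 * u)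
  shift-odds {zero}  _       = trans (cong (at π ∘ shift) (+-identityʳ h)) one-after-evens
  shift-odds {suc u} u+1≤h   =
    trans (cong (at π ∘ shift) (+-suc h u))
          (trans (two-steps (s≤s z≤n) bound (shift-odds (≤-trans (n≤1+n u) u+1≤h))) (cong suc (sym (*-suc 2 u))))
    where
    bound : suc (suc (suc (2 * u))) ≤ M
    bound = s≤s (subst (_≤ 2 * h) (*-suc 2 u) (*-monoʳ-≤ 2 u+1≤h))

  shift-sigma : ∀ {t} → t < M → at π (shift t) ≡ at (sigma (suc h)) t
  shift-sigma {t} t<M with t <? h
  ... | yes t<h = trans (shift-evens t<h) (sym (sigma-even h t<h))
  ... | no t≮h = trans (cong (at π ∘ shift) (sym h+u≡t))
                       (trans (shift-odds u≤h) (trans (sym (sigma-odd h u≤h)) (cong (at (sigma (suc h))) h+u≡t)))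
    where
    h+u≡t : h + (t ∸ h) ≡ t
    h+u≡t = m+[n∸m]≡n (≮⇒≥ t≮h)
    u≤h : t ∸ h ≤ h
    u≤h = +-cancelˡ-≤ h (t ∸ h) h (subst (_≤ h + h) (sym h+u≡t) (subst (t ≤_) (cong (h +_) (+-identityʳ h)) (≤-pred t<M)))

  cyclic-shift : ∀ {i} → i < M → at π i ≡ at (sigma (suc h)) ((i + M ∸ a) % M)
  cyclic-shift {i} i<M = trans (cong (at π) (sym shift-inverse)) (shift-sigma (m%n<n (i + M ∸ a) M))
    where
    open ≡-Reasoning
    shift-inverse : shift ((i + M ∸ a) % M) ≡ i
    shift-inverse = begin
      (a + (i + M ∸ a) % M) % M  ≡⟨ +-%-absorbʳ a (i + M ∸ a) ⟩
      (a + (i + M ∸ a)) % M      ≡⟨ cong (_% M) (m+[n∸m]≡n (≤-trans (<⇒≤ a<M) (m≤n+m M i))) ⟩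
      (i + M) % M                ≡⟨ [m+n]%n≡m%n i M ⟩
      i % M                      ≡⟨ m<n⇒m%n≡m i<M ⟩
      i                          ∎

-- Counting pointer contexts, and deleting the largest entry

length-filter-< : ∀ K p → length (filter (p <?_) (oneToN K)) ≡ K ∸ p
length-filter-< zero    p = sym (0∸n≡0 p)
length-filter-< (suc K) p = begin
  length (filter (p <?_) (oneToN (suc K)))                              ≡⟨ cong (length ∘ filter (p <?_)) (oneToN-suc K) ⟩
  length (filter (p <?_) (oneToN K ++ suc K ∷ []))                      ≡⟨ cong length (filter-++ (p <?_) (oneToN K) _) ⟩
  length (filter (p <?_) (oneToN K) ++ filter (p <?_) (suc K ∷ []))     ≡⟨ length-++ (filter (p <?_) (oneToN K)) ⟩
  length (filter (p <?_) (oneToN K)) + length (filter (p <?_) (suc K ∷ [])) ≡⟨ cong (_+ length (filter (p <?_) (suc K ∷ []))) (length-filter-< K p) ⟩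
  K ∸ p + length (filter (p <?_) (suc K ∷ []))                          ≡⟨ last ⟩
  suc K ∸ p                                                             ∎
  where
  open ≡-Reasoning
  last : K ∸ p + length (filter (p <?_) (suc K ∷ [])) ≡ suc K ∸ p
  last with p <? suc K
  ... | yes p<K+1 = trans (cong (λ l → K ∸ p + length l) (filter-accept (p <?_) {xs = []} p<K+1))
                          (trans (+-comm (K ∸ p) 1) (sym (+-∸-assoc 1 (≤-pred p<K+1))))
  ... | no p≮K+1  = trans (cong (λ l → K ∸ p + length l) (filter-reject (p <?_) {xs = []} p≮K+1))
                          (trans (+-identityʳ _) (trans (m≤n⇒m∸n≡0 (≤-trans (n≤1+n K) p≥K+1)) (sym (m≤n⇒m∸n≡0 p≥K+1))))
    where p≥K+1 = ≮⇒≥ p≮K+1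

pairsWithin : ℕ → ℕ → List (ℕ × ℕ)
pairsWithin K p = map (p ,_) (filter (p <?_) (oneToN K))

length-concatMap-pairsWithin : ∀ K ps → length (concatMap (pairsWithin K) ps) ≡ sum (map (K ∸_) ps)
length-concatMap-pairsWithin K []       = refl
length-concatMap-pairsWithin K (p ∷ ps) = trans (length-++ (pairsWithin K p))
  (cong₂ _+_ (trans (length-map _ (filter (p <?_) (oneToN K))) (length-filter-< K p))
             (length-concatMap-pairsWithin K ps))

sum-map-suc-∸ : ∀ K {ps} → All (_≤ K) ps → sum (map (suc K ∸_) ps) ≡ sum (map (K ∸_) ps) + length ps
sum-map-suc-∸ K []                   = refl
sum-map-suc-∸ K {p ∷ ps} (p≤K ∷ ps≤K) = begin
  suc K ∸ p + sum (map (suc K ∸_) ps)           ≡⟨ cong₂ _+_ (+-∸-assoc 1 p≤K) (sum-map-suc-∸ K ps≤K) ⟩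
  suc (K ∸ p) + (sum (map (K ∸_) ps) + length ps) ≡⟨ cong suc (+-assoc (K ∸ p) _ (length ps)) ⟨
  suc (K ∸ p + sum (map (K ∸_) ps) + length ps)  ≡⟨ +-suc _ (length ps) ⟨
  K ∸ p + sum (map (K ∸_) ps) + suc (length ps)  ∎
  where open ≡-Reasoning

sum-map-∸-oneToN : ∀ K → sum (map (K ∸_) (oneToN K)) ≡ K C 2
sum-map-∸-oneToN zero    = refl
sum-map-∸-oneToN (suc K) = begin
  sum (map (suc K ∸_) (oneToN (suc K)))                           ≡⟨ cong (sum ∘ map (suc K ∸_)) (oneToN-suc K) ⟩
  sum (map (suc K ∸_) (oneToN K ++ suc K ∷ []))                   ≡⟨ cong sum (map-++ (suc K ∸_) (oneToN K) _) ⟩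
  sum (map (suc K ∸_) (oneToN K) ++ (suc K ∸ suc K) ∷ [])         ≡⟨ sum-++ (map (suc K ∸_) (oneToN K)) _ ⟩
  sum (map (suc K ∸_) (oneToN K)) + (suc K ∸ suc K + 0)           ≡⟨ cong₂ _+_ (sum-map-suc-∸ K (All.tabulate (proj₂ ∘ ∈-oneToN⁻))) (cong (_+ 0) (n∸n≡0 K)) ⟩
  sum (map (K ∸_) (oneToN K)) + length (oneToN K) + 0             ≡⟨ +-identityʳ _ ⟩
  sum (map (K ∸_) (oneToN K)) + length (oneToN K)                 ≡⟨ cong₂ _+_ (sum-map-∸-oneToN K) (trans (length-oneToN K) (sym (nC1≡n K))) ⟩
  K C 2 + K C 1                                                   ≡⟨ +-comm (K C 2) (K C 1) ⟩
  K C 1 + K C 2                                                   ≡⟨ nCk+nC[k+1]≡[n+1]C[k+1] K 1 ⟩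
  suc K C 2                                                       ∎
  where open ≡-Reasoning

length-pointerPairs : ∀ N → length (pointerPairs N) ≡ (N ∸ 1) C 2
length-pointerPairs N = trans (length-concatMap-pairsWithin (N ∸ 1) (oneToN (N ∸ 1))) (sum-map-∸-oneToN (N ∸ 1))

maximal-contexts⇒all-interleave : ∀ {N π} → validContexts N π ≡ (N ∸ 1) C 2 →
  ∀ {c d} → 1 ≤ c → c < d → d ≤ N ∸ 1 → Interleave (pointerWord N π) c d
maximal-contexts⇒all-interleave {N} {π} max {c} {d} 1≤c c<d d≤K =
  All.lookup all-pairs (∈-concatMap⁺ (pairsWithin (N ∸ 1)) (lose c∈ (∈-map⁺ (c ,_) (∈-filter⁺ (c <?_) d∈ c<d))))
  where
  interleave?′ = λ (pq : ℕ × ℕ) → interleave? (pointerWord N π) (proj₁ pq) (proj₂ pq)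
  all-pairs : All (λ pq → Interleave (pointerWord N π) (proj₁ pq) (proj₂ pq)) (pointerPairs N)
  all-pairs = subst (All _) (filter-complete interleave?′ (trans max (sym (length-pointerPairs N))))
                    (All.all-filter interleave?′ (pointerPairs N))
  c∈ = ∈-oneToN⁺ 1≤c (≤-trans (<⇒≤ c<d) d≤K)
  d∈ = ∈-oneToN⁺ (≤-trans 1≤c (<⇒≤ c<d)) d≤K

module Contraction (M : ℕ) where

  kept? : ∀ x → Dec (¬ x ≡ suc M)
  kept? x = ¬? (x ≟ suc M)

  notLast? : ∀ c → Dec (¬ c ≡ M)
  notLast? c = ¬? (c ≟ M)

  contraction-perm : ∀ {τ} → IsPerm (suc M) τ → IsPerm M (filter kept? τ)
  contraction-perm τ-perm = ↭-trans (filter-↭ kept? τ-perm) (↭-reflexive oneToN-without-last)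
    where
    oneToN-without-last : filter kept? (oneToN (suc M)) ≡ oneToN M
    oneToN-without-last = begin
      filter kept? (oneToN (suc M))                              ≡⟨ cong (filter kept?) (oneToN-suc M) ⟩
      filter kept? (oneToN M ++ suc M ∷ [])                      ≡⟨ filter-++ kept? (oneToN M) _ ⟩
      filter kept? (oneToN M) ++ filter kept? (suc M ∷ [])       ≡⟨ cong₂ _++_ (filter-all kept? (All.tabulate below)) (filter-reject kept? (λ ne → ne refl)) ⟩
      oneToN M ++ []                                             ≡⟨ ++-identityʳ _ ⟩
      oneToN M                                                   ∎
      where
      open ≡-Reasoning
      below : ∀ {x} → x ∈ oneToN M → ¬ x ≡ suc M
      below x∈ refl = <-irrefl refl (s≤s (proj₂ (∈-oneToN⁻ x∈)))

  isPointer-contraction : ∀ cs → filter (isPointer? M) cs ≡ filter notLast? (filter (isPointer? (suc M)) cs)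
  isPointer-contraction = filter-∩ notLast? (isPointer? (suc M)) (isPointer? M)
    (λ (1≤c , c<M) → (λ c≡M → <-irrefl c≡M c<M) , 1≤c , m≤n⇒m≤1+n c<M)
    (λ c≢M (1≤c , c<M+1) → 1≤c , ≤∧≢⇒< (≤-pred c<M+1) c≢M)

  pointerWord-contraction : ∀ τ → pointerWord M (filter kept? τ) ≡ filter notLast? (pointerWord (suc M) τ)
  pointerWord-contraction []       = refl
  pointerWord-contraction (x ∷ τ) with x ≟ suc M
  ... | yes refl = begin
    pointerWord M (filter kept? (suc M ∷ τ))                         ≡⟨ cong (pointerWord M) (filter-reject kept? (λ ne → ne refl)) ⟩
    pointerWord M (filter kept? τ)                                   ≡⟨ pointerWord-contraction τ ⟩
    filter notLast? (pointerWord (suc M) τ)                          ≡⟨ cong (_++ filter notLast? (pointerWord (suc M) τ)) lastBlock ⟨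
    filter notLast? (filter (isPointer? (suc M)) (M ∷ suc M ∷ [])) ++
      filter notLast? (pointerWord (suc M) τ)                        ≡⟨ filter-++ notLast? (filter (isPointer? (suc M)) (M ∷ suc M ∷ [])) _ ⟨
    filter notLast? (pointerWord (suc M) (suc M ∷ τ))                ∎
    where
    open ≡-Reasoning
    lastBlock : filter notLast? (filter (isPointer? (suc M)) (M ∷ suc M ∷ [])) ≡ []
    lastBlock = trans (sym (isPointer-contraction (M ∷ suc M ∷ [])))
      (filter-none (isPointer? M) ((λ (_ , M<M) → <-irrefl refl M<M) ∷ (λ (_ , M+1<M) → <-asym (n<1+n M) M+1<M) ∷ []))
  ... | no x≢M+1 = begin
    pointerWord M (filter kept? (x ∷ τ))                             ≡⟨ cong (pointerWord M) (filter-accept kept? x≢M+1) ⟩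
    filter (isPointer? M) (x ∸ 1 ∷ x ∷ []) ++ pointerWord M (filter kept? τ)
                                                                     ≡⟨ cong₂ _++_ (isPointer-contraction (x ∸ 1 ∷ x ∷ [])) (pointerWord-contraction τ) ⟩
    filter notLast? (filter (isPointer? (suc M)) (x ∸ 1 ∷ x ∷ [])) ++
      filter notLast? (pointerWord (suc M) τ)                        ≡⟨ filter-++ notLast? (filter (isPointer? (suc M)) (x ∸ 1 ∷ x ∷ [])) _ ⟨
    filter notLast? (pointerWord (suc M) (x ∷ τ))                    ∎
    where open ≡-Reasoning

  contraction-interleave : ∀ {τ} →
    (∀ {c d} → 1 ≤ c → c < d → d ≤ M → Interleave (pointerWord (suc M) τ) c d) →
    ∀ {c d} → 1 ≤ c → c < d → d < M → Interleave (pointerWord M (filter kept? τ)) c d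
  contraction-interleave {τ} il {c} {d} 1≤c c<d d<M =
    subst (λ W → Interleave W c d) (sym (pointerWord-contraction τ)) ([ inj₁ ∘ restrict , inj₂ ∘ restrict′ ]′ (il 1≤c c<d (<⇒≤ d<M)))
    where
    c≢M : ¬ c ≡ M
    c≢M c≡M = <-irrefl c≡M (<-trans c<d d<M)
    d≢M : ¬ d ≡ M
    d≢M d≡M = <-irrefl d≡M d<M
    keep : ∀ {xs ys} → All (λ c → ¬ c ≡ M) xs → xs ⊆ ys → xs ⊆ filter notLast? ys
    keep ok sub = subst (_⊆ _) (filter-all notLast? ok) (filter⁺ notLast? notLast? (λ { refl p → p }) sub)
    restrict  = keep (c≢M ∷ d≢M ∷ c≢M ∷ d≢M ∷ [])
    restrict′ = keep (d≢M ∷ c≢M ∷ d≢M ∷ c≢M ∷ [])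

all-interleave⇒cyclic-shift : ∀ {k M π} → M ≡ suc (2 * suc k) → IsPerm M π →
  (∀ {c d} → 1 ≤ c → c < d → d < M → Interleave (pointerWord M π) c d) →
  Σ ℕ λ a → a < M × ((i : ℕ) → i < M → at π i ≡ at (sigma (suc (suc k))) (modN (i + M ∸ a) M))
all-interleave⇒cyclic-shift refl π-perm all-interleave = a , a<M , λ _ → cyclic-shift
  where open CyclicShift π-perm all-interleave

theorem4p9 : (n : ℕ) → 2 ≤ n → (π : List ℕ) → InM n ((2 * n ∸ 1) C 2) π →
    Σ ℕ λ a → a < 2 * n ∸ 1 ×
      ((i : ℕ) → i < 2 * n ∸ 1 →
        at π i ≡ at (sigma n) (modN (i + (2 * n ∸ 1) ∸ a) (2 * n ∸ 1)))
theorem4p9 (suc (suc k)) _ _ (τ , τ-perm , _ , maximal , refl) =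
  all-interleave⇒cyclic-shift (cong suc (+-suc k (suc (k + 0)))) (contraction-perm τ-perm)
    (contraction-interleave {τ} (maximal-contexts⇒all-interleave {2 * suc (suc k)} {τ} maximal))
  where open Contraction (2 * suc (suc k) ∸ 1)
theorem4p9 1 (s≤s ()) _ _
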